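{- Let $k\geq 2$ and $n\geq 1$ be integers, let $t_1,\dots,t_k$ be indeterminates, and work in the field $\mathbb{C}(t_1,\dots,t_k)$ of rational functions. Set $t_0=1$. Let $L_{k,n}=(l_{rs})_{1\le r,s\le n}$ be the $n\times n$ lower Hessenberg matrix with $$l_{rs}=\begin{cases} \dfrac{t_{r-s+1}}{t_2^{\,r-s}} & \text{if } -1\leq r-s<k,\\[2mm] 0 & \text{otherwise.}\end{cases}$$ (Thus the superdiagonal entries are $t_2$, the diagonal entries are $t_1$, the subdiagonal entries are $1$, and the entries with $r-s=d$, $2\le d\le k-1$, are $t_{d+1}/t_2^{d}$.) Then $$\operatorname{per}(L_{k,n})=F_{k,n+1}(t),$$ where $\operatorname{per}(A)=\sum_{\sigma\in S_n}\prod_{r=1}^n a_{r,\sigma(r)}$ denotes the permanent.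
   Context: The generalized Fibonacci polynomials $F_{k,n}(t)$, $t=(t_1,\dots,t_k)$, are defined by $F_{k,n}(t)=0$ for $n<1$, $F_{k,1}(t)=1$, $F_{k,2}(t)=t_1$, and $F_{k,n+1}(t)=t_1F_{k,n}(t)+t_2F_{k,n-1}(t)+\cdots+t_kF_{k,n-k+1}(t)$ for $n\ge 1$. -}

module Defs where

open import Level using (Level)
open import Algebra.Bundles using (CommutativeRing)
open import Data.Nat as ℕ using (ℕ; zero; suc; _<ᵇ_)
open import Data.Bool using (Bool; true; false; if_then_else_)
open import Data.Fin as Fin using (Fin; toℕ)
open import Data.Fin.Properties using (_≟_)
open import Data.List as List using (List; []; _∷_; concatMap; filter; allFin)
open import Data.Vec as Vec using (Vec; lookup)
import Data.List.Relation.Unary.Unique.DecPropositional as UniqueDec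

allVecs : (m n : ℕ) → List (Vec (Fin n) m)
allVecs zero    n = Vec.[] ∷ []
allVecs (suc m) n =
  concatMap (λ i → List.map (i Vec.∷_) (allVecs m n)) (allFin n)

-- The symmetric group S_n: maps σ : Fin n → Fin n (given as the vector
-- (σ 0, …, σ (n-1))) which are injective, i.e. have pairwise distinct values.
permutations : (n : ℕ) → List (Vec (Fin n) n)
permutations n = filter (λ σ → UniqueDec.unique? _≟_ (Vec.toList σ)) (allVecs n n)

module _ {c ℓ : Level} (R : CommutativeRing c ℓ) where
  open CommutativeRing R using (Carrier; _+_; _*_; 0#; 1#)

  ΣL : List Carrier → Carrier
  ΣL = List.foldr _+_ 0#

  ΠV : ∀ {m} → Vec Carrier m → Carrier
  ΠV = Vec.foldr _ _*_ 1#

  infixr 8 _^_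
  _^_ : Carrier → ℕ → Carrier
  x ^ zero  = 1#
  x ^ suc m = x * (x ^ m)

  per : (n : ℕ) → (Fin n → Fin n → Carrier) → Carrier
  per n a = ΣL (List.map (λ σ → ΠV (Vec.tabulate (λ r → a r (lookup σ r))))
                         (permutations n))

  -- Generalized Fibonacci polynomials F_{k,m}(t), with t_i = t i for 1 ≤ i ≤ k
  -- (values of t at other indices are never used).
  -- hist k t m = [F_{k,m}, F_{k,m-1}, …, F_{k,0}];  F_{k,j} = 0 for j < 1.
  lookupOr0 : List Carrier → ℕ → Carrier
  lookupOr0 []       _       = 0#
  lookupOr0 (x ∷ xs) zero    = x
  lookupOr0 (x ∷ xs) (suc j) = lookupOr0 xs j

  hist : (k : ℕ) → (ℕ → Carrier) → ℕ → List Carrier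
  hist k t zero          = 0# ∷ []
  hist k t (suc zero)    = 1# ∷ hist k t zero
  -- F_{k,m+1} = t_1 F_{k,m} + t_2 F_{k,m-1} + ⋯ + t_k F_{k,m-k+1}   (m ≥ 1)
  hist k t (suc (suc m)) =
    ΣL (List.map (λ j → t (suc j) * lookupOr0 (hist k t (suc m)) j) (List.upTo k))
      ∷ hist k t (suc m)

  F : (k : ℕ) → (ℕ → Carrier) → ℕ → Carrier
  F k t m = lookupOr0 (hist k t m) 0

  -- The matrix L_{k,n} (0-based indices r, s ∈ Fin n, which does not change r - s).
  -- u is the inverse of t_2 (t_0 = 1):
  --   r - s = -1        : t_0 / t_2^{-1} = t_2
  --   r - s = d, 0 ≤ d < k : t_{d+1} / t_2^d = t_{d+1} * u^d
  --   otherwise         : 0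
  Lmat : (k : ℕ) → (ℕ → Carrier) → (u : Carrier) → (n : ℕ) → Fin n → Fin n → Carrier
  Lmat k t u n r s =
    if suc (toℕ r) ℕ.≡ᵇ toℕ s then t 2
    else if toℕ s ℕ.≤ᵇ toℕ r then
      (if (toℕ r ℕ.∸ toℕ s) <ᵇ k
         then t (suc (toℕ r ℕ.∸ toℕ s)) * (u ^ (toℕ r ℕ.∸ toℕ s))
         else 0#)
    else 0#

-- Expand the permanent row by row. Because L is lower Hessenberg, when row r is reached the
-- rows above it have used every column 0, …, r except one, say p, and row r can only use p or
-- the column r + 1. The entries of L depend only on r − s, so what remains depends only on the
-- number of rows left and on e = r − p, and satisfies a two-term recurrence.
-- Multiplying by t₂ᵉ cancels the factor t₂⁻ᵉ in the entry t_{e+1} / t₂ᵉ, and the recurrence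
-- unfolds into the defining recurrence F_{k,m+2} = Σ_{j<k} t_{j+1} F_{k,m+1−j}.
module Submission where

open import Defs hiding (_^_)
open import Defs using () renaming (_^_ to power)
open import Algebra.Bundles using (CommutativeRing)
open import Data.Nat as ℕ
  using (ℕ; zero; suc; _∸_; _≤_; _<_; _≰_; _≮_; _≡ᵇ_; _≤ᵇ_; _<ᵇ_; z≤n; s≤s)
import Data.Nat.Properties as ℕₚ
open ℕₚ using (_≟_; _≤?_; _<?_; <ᵇ-reflects-<)
open import Data.Bool using (Bool; true; false; not; _∧_; _∨_; if_then_else_; T)
open import Data.Bool.Properties using (∨-conicalˡ; ∨-conicalʳ; T-≡; if-cong)
open import Data.Fin as Fin using (Fin; toℕ)
open import Data.Fin.Properties using (toℕ-injective)
open import Data.List using (List; []; _∷_; _++_; map; filter; concatMap; allFin; upTo; applyUpTo)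
open import Data.List.Properties using (map-cong; map-∘; map-++; map-tabulate; map-upTo; map-applyUpTo)
open import Data.List.Relation.Unary.All as All using (All; []; _∷_)
open import Data.List.Relation.Unary.AllPairs using ([]; _∷_)
open import Data.List.Relation.Unary.Unique.Propositional using (Unique)
import Data.List.Relation.Unary.Unique.DecPropositional as UniqueDec
open import Data.Product using (_×_; _,_; proj₁)
open import Data.Vec using (Vec; []; _∷_; lookup; tabulate; toList)
open import Data.Vec.Properties using (tabulate-cong)
open import Function using (_∘_)
open import Function.Bundles using (Equivalence)
open import Relation.Binary.PropositionalEquality as ≡ using (_≡_; _≢_; _≗_; refl; cong; cong₂)
open import Relation.Nullary using (does; proof; yes; no)
open import Relation.Nullary.Decidable using (dec-true; dec-false)
open import Relation.Nullary.Reflects using (ofʸ; ofⁿ; fromEquivalence; det)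
open import Relation.Unary using (Pred; Decidable)

≡ᵇ-true : ∀ {m n} → m ≡ n → (m ≡ᵇ n) ≡ true
≡ᵇ-true = dec-true (_ ≟ _)

≡ᵇ-false : ∀ {m n} → m ≢ n → (m ≡ᵇ n) ≡ false
≡ᵇ-false = dec-false (_ ≟ _)

≤ᵇ-true : ∀ {m n} → m ≤ n → (m ≤ᵇ n) ≡ true
≤ᵇ-true = dec-true (_ ≤? _)

≤ᵇ-false : ∀ {m n} → m ≰ n → (m ≤ᵇ n) ≡ false
≤ᵇ-false = dec-false (_ ≤? _)

<ᵇ-true : ∀ {m n} → m < n → (m <ᵇ n) ≡ true
<ᵇ-true = dec-true (_ <? _)

<ᵇ-false : ∀ {m n} → m ≮ n → (m <ᵇ n) ≡ false
<ᵇ-false = dec-false (_ <? _)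

≡ᵇ-false⇒≢ : ∀ {m n} → (m ≡ᵇ n) ≡ false → m ≢ n
≡ᵇ-false⇒≢ m≡ᵇn m≡n = ≡.subst T m≡ᵇn (ℕₚ.≡⇒≡ᵇ _ _ m≡n)

map-applyUpTo-suc : ∀ {b} {B : Set b} (f : ℕ → B) n →
                    map f (applyUpTo suc n) ≡ map (f ∘ suc) (upTo n)
map-applyUpTo-suc f n = ≡.trans (map-applyUpTo suc f n) (≡.sym (map-upTo (f ∘ suc) n))

data Position (p r : ℕ) : ℕ → Set where
  before : ∀ {j} → j ≤ r → p ≢ j → Position p r j
  at     : Position p r p
  next   : Position p r (suc r)
  after  : ∀ {j} → suc r < j → Position p r j

position : ∀ p r j → Position p r j
position p r j with p ≟ j
... | yes refl = at
... | no p≢j with j ≤? r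
...   | yes j≤r = before j≤r p≢j
...   | no j≰r with suc r ≟ j
...     | yes refl  = next
...     | no 1+r≢j = after (ℕₚ.≤∧≢⇒< (ℕₚ.≰⇒> j≰r) 1+r≢j)

module _ {ℓ₁ ℓ₂} (R : CommutativeRing ℓ₁ ℓ₂) where
  open CommutativeRing R
    using (Carrier; _≈_; _+_; _*_; 0#; 1#; setoid; reflexive; +-cong; +-congˡ; +-congʳ; +-assoc;
           +-identityˡ; +-identityʳ; *-cong; *-congˡ; *-congʳ; *-assoc; *-comm; *-identityˡ; *-identityʳ;
           zeroˡ; zeroʳ; distribˡ; +-commutativeSemigroup; *-commutativeSemigroup)
    renaming (refl to ≈-refl; sym to ≈-sym; trans to ≈-trans)
  open import Algebra.Properties.CommutativeSemigroup +-commutativeSemigroup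
    using () renaming (interchange to +-interchange)
  open import Algebra.Properties.CommutativeSemigroup *-commutativeSemigroup
    using () renaming (interchange to *-interchange)
  open import Relation.Binary.Reasoning.Setoid setoid

  ∑ : List Carrier → Carrier
  ∑ = ΣL R

  infixr 8 _^_
  _^_ : Carrier → ℕ → Carrier
  _^_ = power R

  ^-cancel : ∀ {x y} → x * y ≈ 1# → ∀ e z → y ^ e * (z * x ^ e) ≈ z
  ^-cancel {x} {y} xy≈1 e z = begin
    y ^ e * (z * x ^ e)  ≈⟨ *-congˡ (*-comm z _) ⟩
    y ^ e * (x ^ e * z)  ≈⟨ *-assoc _ _ _ ⟨
    (y ^ e * x ^ e) * z  ≈⟨ *-congʳ (^-inverse e) ⟩
    1# * z               ≈⟨ *-identityˡ z ⟩
    z                    ∎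
    where
    ^-inverse : ∀ e → y ^ e * x ^ e ≈ 1#
    ^-inverse zero    = *-identityʳ 1#
    ^-inverse (suc e) = begin
      (y * y ^ e) * (x * x ^ e)  ≈⟨ *-interchange _ _ _ _ ⟩
      (y * x) * (y ^ e * x ^ e)  ≈⟨ *-cong (≈-trans (*-comm y x) xy≈1) (^-inverse e) ⟩
      1# * 1#                    ≈⟨ *-identityʳ 1# ⟩
      1#                         ∎

  if-*ˡ : ∀ b x y → (if b then x * y else 0#) ≈ x * (if b then y else 0#)
  if-*ˡ true  x y = ≈-refl
  if-*ˡ false x y = ≈-sym (zeroʳ x)

  module _ {a} {A : Set a} where
    ∑-cong : ∀ {f g : A → Carrier} → (∀ x → f x ≈ g x) →
             ∀ xs → ∑ (map f xs) ≈ ∑ (map g xs)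
    ∑-cong f≈g []       = ≈-refl
    ∑-cong f≈g (x ∷ xs) = +-cong (f≈g x) (∑-cong f≈g xs)

    ∑-zero : ∀ {f : A → Carrier} → (∀ x → f x ≈ 0#) → ∀ xs → ∑ (map f xs) ≈ 0#
    ∑-zero f≈0 []       = ≈-refl
    ∑-zero f≈0 (x ∷ xs) = ≈-trans (+-cong (f≈0 x) (∑-zero f≈0 xs)) (+-identityʳ 0#)

    ∑-+ : ∀ (f g : A → Carrier) xs →
          ∑ (map (λ x → f x + g x) xs) ≈ ∑ (map f xs) + ∑ (map g xs)
    ∑-+ f g []       = ≈-sym (+-identityʳ 0#)
    ∑-+ f g (x ∷ xs) = ≈-trans (+-congˡ (∑-+ f g xs)) (+-interchange _ _ _ _)

    ∑-*ˡ : ∀ y (f : A → Carrier) xs → ∑ (map (λ x → y * f x) xs) ≈ y * ∑ (map f xs)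
    ∑-*ˡ y f []       = ≈-sym (zeroʳ y)
    ∑-*ˡ y f (x ∷ xs) = ≈-trans (+-congˡ (∑-*ˡ y f xs)) (≈-sym (distribˡ y (f x) _))

    ∑-filter : ∀ {p} {P : Pred A p} (P? : Decidable P) (f : A → Carrier) xs →
               ∑ (map f (filter P? xs)) ≈ ∑ (map (λ x → if does (P? x) then f x else 0#) xs)
    ∑-filter P? f []       = ≈-refl
    ∑-filter P? f (x ∷ xs) with does (P? x)
    ... | true  = +-congˡ (∑-filter P? f xs)
    ... | false = ≈-trans (∑-filter P? f xs) (≈-sym (+-identityˡ _))

  ∑-++ : ∀ xs ys → ∑ (xs ++ ys) ≈ ∑ xs + ∑ ys
  ∑-++ []       ys = ≈-sym (+-identityˡ _)
  ∑-++ (x ∷ xs) ys = ≈-trans (+-congˡ (∑-++ xs ys)) (≈-sym (+-assoc x _ _))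

  ∑-concatMap : ∀ {a b} {A : Set a} {B : Set b} (f : B → Carrier) (g : A → List B) xs →
                ∑ (map f (concatMap g xs)) ≈ ∑ (map (λ x → ∑ (map f (g x))) xs)
  ∑-concatMap f g []       = ≈-refl
  ∑-concatMap f g (x ∷ xs) = begin
    ∑ (map f (g x ++ concatMap g xs))             ≡⟨ cong ∑ (map-++ f (g x) _) ⟩
    ∑ (map f (g x) ++ map f (concatMap g xs))     ≈⟨ ∑-++ (map f (g x)) _ ⟩
    ∑ (map f (g x)) + ∑ (map f (concatMap g xs))  ≈⟨ +-congˡ (∑-concatMap f g xs) ⟩
    _                                             ∎

  ∑-allFin-suc : ∀ n (f : Fin (suc n) → Carrier) →
                 ∑ (map f (allFin (suc n))) ≈ f Fin.zero + ∑ (map (f ∘ Fin.suc) (allFin n))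
  ∑-allFin-suc n f = reflexive (cong (λ xs → f Fin.zero + ∑ xs)
    (≡.trans (map-tabulate Fin.suc f) (≡.sym (map-tabulate (λ i → i) (f ∘ Fin.suc)))))

  ∑-indicator : ∀ n q x →
                ∑ (map (λ i → if q ≡ᵇ toℕ i then x else 0#) (allFin n)) ≈ (if q <ᵇ n then x else 0#)
  ∑-indicator zero    q       x = ≈-refl
  ∑-indicator (suc n) zero    x =
    ≈-trans (∑-allFin-suc n (λ i → if 0 ≡ᵇ toℕ i then x else 0#))
    (≈-trans (+-congˡ (∑-zero (λ _ → ≈-refl) (allFin n))) (+-identityʳ x))
  ∑-indicator (suc n) (suc q) x =
    ≈-trans (∑-allFin-suc n (λ i → if suc q ≡ᵇ toℕ i then x else 0#))
    (≈-trans (+-identityˡ _) (∑-indicator n q x))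

  module RowExpansion (n : ℕ) (a : ℕ → ℕ → Carrier) where
    open UniqueDec (Fin._≟_ {n}) using (unique?)

    insert : ℕ → (ℕ → Bool) → ℕ → Bool
    insert i used j = used j ∨ (i ≡ᵇ j)

    perFrom : ℕ → (ℕ → Bool) → ℕ → Carrier
    perFrom zero    used r = 1#
    perFrom (suc m) used r = ∑ (map (λ i → if used (toℕ i) then 0#
      else a r (toℕ i) * perFrom m (insert (toℕ i) used) (suc r)) (allFin n))

    fresh : ∀ {m} → (ℕ → Bool) → Vec (Fin n) m → Bool
    fresh used []      = true
    fresh used (i ∷ v) = not (used (toℕ i)) ∧ fresh (insert (toℕ i) used) v

    product : ∀ {m} → ℕ → Vec (Fin n) m → Carrier
    product r []      = 1#
    product r (i ∷ v) = a r (toℕ i) * product (suc r) v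

    ΠV-tabulate : ∀ {m} r (v : Vec (Fin n) m) →
                  ΠV R (tabulate (λ x → a (r ℕ.+ toℕ x) (toℕ (lookup v x)))) ≡ product r v
    ΠV-tabulate r []      = refl
    ΠV-tabulate r (i ∷ v) = cong₂ _*_
      (cong (λ q → a q (toℕ i)) (ℕₚ.+-identityʳ r))
      (≡.trans (cong (ΠV R) (tabulate-cong λ x → cong (λ q → a q (toℕ (lookup v x))) (ℕₚ.+-suc r (toℕ x))))
               (ΠV-tabulate (suc r) v))

    fresh-sound : ∀ {m} used (v : Vec (Fin n) m) → fresh used v ≡ true →
                  Unique (toList v) × All (λ j → used (toℕ j) ≡ false) (toList v)
    fresh-sound used []      _ = [] , []
    fresh-sound used (i ∷ v) fresh≡true with used (toℕ i) in usedᵢ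
    ... | true  with () ← fresh≡true
    ... | false with fresh-sound (insert (toℕ i) used) v fresh≡true
    ...   | unique , unused =
      All.map (λ {j} e → ≡ᵇ-false⇒≢ (∨-conicalʳ (used (toℕ j)) _ e) ∘ cong toℕ) unused ∷ unique
      , usedᵢ ∷ All.map (λ {j} → ∨-conicalˡ (used (toℕ j)) _) unused

    fresh-complete : ∀ {m} used (v : Vec (Fin n) m) → Unique (toList v) →
                     All (λ j → used (toℕ j) ≡ false) (toList v) → fresh used v ≡ true
    fresh-complete used []      _              _                  = refl
    fresh-complete used (i ∷ v) (i∉v ∷ unique) (unusedᵢ ∷ unused) rewrite unusedᵢ =
      fresh-complete (insert (toℕ i) used) v unique (All.zipWith
        (λ (i≢j , unusedⱼ) → cong₂ _∨_ unusedⱼ (≡ᵇ-false (i≢j ∘ toℕ-injective))) (i∉v , unused))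

    unique?≡fresh : ∀ {m} (σ : Vec (Fin n) m) → does (unique? (toList σ)) ≡ fresh (λ _ → false) σ
    unique?≡fresh σ = det (proof (unique? (toList σ))) (fromEquivalence
      (λ fresh → proj₁ (fresh-sound _ σ (Equivalence.to T-≡ fresh)))
      (λ unique → Equivalence.from T-≡
        (fresh-complete _ σ unique (All.universal (λ _ → refl) (toList σ)))))

    ∑-fresh : ∀ m used r →
              ∑ (map (λ v → if fresh used v then product r v else 0#) (allVecs m n)) ≈ perFrom m used r
    ∑-fresh zero    used r = +-identityʳ 1#
    ∑-fresh (suc m) used r =
      ≈-trans (∑-concatMap (term r used) (λ i → map (i ∷_) (allVecs m n)) (allFin n))
              (∑-cong column (allFin n))
      where
      term : ∀ {l} → ℕ → (ℕ → Bool) → Vec (Fin n) l → Carrier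
      term r used v = if fresh used v then product r v else 0#

      column : ∀ i → ∑ (map (term r used) (map (i ∷_) (allVecs m n)))
                   ≈ (if used (toℕ i) then 0#
                      else a r (toℕ i) * perFrom m (insert (toℕ i) used) (suc r))
      column i rewrite ≡.sym (map-∘ {g = term r used} {f = i ∷_} (allVecs m n)) with used (toℕ i)
      ... | true  = ∑-zero (λ _ → ≈-refl) (allVecs m n)
      ... | false = begin
        ∑ (map (λ v → if fresh (insert (toℕ i) used) v then a r (toℕ i) * product (suc r) v else 0#)
               (allVecs m n))
          ≈⟨ ∑-cong (λ v → if-*ˡ (fresh (insert (toℕ i) used) v) _ _) (allVecs m n) ⟩
        ∑ (map (λ v → a r (toℕ i) * term (suc r) (insert (toℕ i) used) v) (allVecs m n))
          ≈⟨ ∑-*ˡ (a r (toℕ i)) _ (allVecs m n) ⟩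
        a r (toℕ i) * ∑ (map (term (suc r) (insert (toℕ i) used)) (allVecs m n))
          ≈⟨ *-congˡ (∑-fresh m (insert (toℕ i) used) (suc r)) ⟩
        a r (toℕ i) * perFrom m (insert (toℕ i) used) (suc r) ∎

    per≈perFrom : per R n (λ r s → a (toℕ r) (toℕ s)) ≈ perFrom n (λ _ → false) 0
    per≈perFrom = begin
      per R n (λ r s → a (toℕ r) (toℕ s))
        ≈⟨ ∑-filter (unique? ∘ toList) _ (allVecs n n) ⟩
      ∑ (map (λ σ → if does (unique? (toList σ)) then ΠV R (tabulate (λ r → a (toℕ r) (toℕ (lookup σ r))))
                   else 0#) (allVecs n n))
        ≡⟨ cong ∑ (map-cong (λ σ → cong₂ (λ b x → if b then x else 0#) (unique?≡fresh σ) (ΠV-tabulate 0 σ))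
                            (allVecs n n)) ⟩
      ∑ (map (λ σ → if fresh (λ _ → false) σ then product 0 σ else 0#) (allVecs n n))
        ≈⟨ ∑-fresh n (λ _ → false) 0 ⟩
      perFrom n (λ _ → false) 0 ∎

  module ToeplitzHessenberg (c : Carrier) (h : ℕ → Carrier) where
    entry : ℕ → ℕ → Carrier
    entry r s = if suc r ≡ᵇ s then c else if s ≤ᵇ r then h (r ∸ s) else 0#

    -- The permanent of the m × m matrix entry with its first column replaced by h e, …, h (e + m − 1),
    -- expanded along the first row; perShifted m 0 is the permanent of entry itself.
    perShifted : ℕ → ℕ → Carrier
    perShifted zero          e = 1#
    perShifted (suc zero)    e = h e
    perShifted (suc (suc m)) e = h e * perShifted (suc m) 0 + c * perShifted (suc m) (suc e)

    gapped : ℕ → ℕ → ℕ → Bool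
    gapped r p j = (j ≤ᵇ r) ∧ not (p ≡ᵇ j)

    module _ {n : ℕ} where
      open RowExpansion n entry

      row<n : ∀ {r m} → r ℕ.+ suc m ≡ n → r < n
      row<n {r} r+m≡n = ≡.subst (r <_) r+m≡n (ℕₚ.m<m+n r ℕ.z<s)

      insert-at : ∀ {r p used} → p ≤ r → used ≗ gapped r p → insert p used ≗ gapped (suc r) (suc r)
      insert-at {r} {p} p≤r spec j rewrite spec j with position p r j
      ... | before j≤r p≢j rewrite ≤ᵇ-true j≤r | ≡ᵇ-false p≢j | ≤ᵇ-true (ℕₚ.m≤n⇒m≤1+n j≤r)
                                 | ≡ᵇ-false (ℕₚ.>⇒≢ (s≤s j≤r)) = refl
      ... | at rewrite ≤ᵇ-true p≤r | ≡ᵇ-true {p} refl | ≤ᵇ-true (ℕₚ.m≤n⇒m≤1+n p≤r)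
                     | ≡ᵇ-false (ℕₚ.>⇒≢ (s≤s p≤r)) = refl
      ... | next rewrite <ᵇ-false (ℕₚ.n≮n r) | ≡ᵇ-false (ℕₚ.<⇒≢ (s≤s p≤r)) | <ᵇ-true (ℕₚ.n<1+n r)
                       | ≡ᵇ-true {r} refl = refl
      ... | after 1+r<j rewrite ≤ᵇ-false (ℕₚ.<⇒≱ (ℕₚ.<⇒≤ 1+r<j))
                              | ≡ᵇ-false (ℕₚ.<⇒≢ (ℕₚ.≤-<-trans p≤r (ℕₚ.<⇒≤ 1+r<j)))
                              | ≤ᵇ-false (ℕₚ.<⇒≱ 1+r<j) = refl

      insert-next : ∀ {r p used} → p ≤ r → used ≗ gapped r p → insert (suc r) used ≗ gapped (suc r) p
      insert-next {r} {p} p≤r spec j rewrite spec j with position p r j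
      ... | before j≤r p≢j rewrite ≤ᵇ-true j≤r | ≡ᵇ-false p≢j | ≤ᵇ-true (ℕₚ.m≤n⇒m≤1+n j≤r) = refl
      ... | at rewrite ≤ᵇ-true p≤r | ≡ᵇ-true {p} refl | ≤ᵇ-true (ℕₚ.m≤n⇒m≤1+n p≤r)
                     | ≡ᵇ-false (ℕₚ.>⇒≢ (s≤s p≤r)) = refl
      ... | next rewrite <ᵇ-false (ℕₚ.n≮n r) | ≡ᵇ-false (ℕₚ.<⇒≢ (s≤s p≤r)) | <ᵇ-true (ℕₚ.n<1+n r)
                       | ≡ᵇ-true {r} refl = refl
      ... | after 1+r<j rewrite ≤ᵇ-false (ℕₚ.<⇒≱ (ℕₚ.<⇒≤ 1+r<j))
                              | ≡ᵇ-false (ℕₚ.<⇒≢ 1+r<j)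
                              | ≤ᵇ-false (ℕₚ.<⇒≱ 1+r<j) = refl

      column-step : ∀ m {r p used} → p ≤ r → used ≗ gapped r p → ∀ j →
        (if used j then 0# else entry r j * perFrom m (insert j used) (suc r))
          ≈ (if p ≡ᵇ j then h (r ∸ p) * perFrom m (insert p used) (suc r) else 0#)
            + (if suc r ≡ᵇ j then c * perFrom m (insert (suc r) used) (suc r) else 0#)
      column-step m {r} {p} {used} p≤r spec j rewrite spec j with position p r j
      ... | before j≤r p≢j rewrite ≤ᵇ-true j≤r | ≡ᵇ-false p≢j
                                 | ≡ᵇ-false (ℕₚ.>⇒≢ (s≤s j≤r)) = ≈-sym (+-identityʳ 0#)
      ... | at rewrite ≤ᵇ-true p≤r | ≡ᵇ-true {p} refl
                     | ≡ᵇ-false (ℕₚ.>⇒≢ (s≤s p≤r)) = ≈-sym (+-identityʳ _)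
      ... | next rewrite <ᵇ-false (ℕₚ.n≮n r) | ≡ᵇ-false (ℕₚ.<⇒≢ (s≤s p≤r))
                       | ≡ᵇ-true {r} refl = ≈-sym (+-identityˡ _)
      ... | after 1+r<j rewrite ≤ᵇ-false (ℕₚ.<⇒≱ (ℕₚ.<⇒≤ 1+r<j))
                              | ≡ᵇ-false (ℕₚ.<⇒≢ (ℕₚ.≤-<-trans p≤r (ℕₚ.<⇒≤ 1+r<j)))
                              | ≡ᵇ-false (ℕₚ.<⇒≢ 1+r<j) = ≈-trans (zeroˡ _) (≈-sym (+-identityʳ 0#))

      row-expansion : ∀ m {r p used} → p ≤ r → r < n → used ≗ gapped r p →
        perFrom (suc m) used r
          ≈ h (r ∸ p) * perFrom m (insert p used) (suc r)
            + (if suc r <ᵇ n then c * perFrom m (insert (suc r) used) (suc r) else 0#)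
      row-expansion m {r} {p} {used} p≤r r<n spec = begin
        perFrom (suc m) used r
          ≈⟨ ∑-cong (column-step m p≤r spec ∘ toℕ) (allFin n) ⟩
        ∑ (map (λ i → (if p ≡ᵇ toℕ i then X else 0#) + (if suc r ≡ᵇ toℕ i then Y else 0#)) (allFin n))
          ≈⟨ ∑-+ _ _ (allFin n) ⟩
        ∑ (map (λ i → if p ≡ᵇ toℕ i then X else 0#) (allFin n))
          + ∑ (map (λ i → if suc r ≡ᵇ toℕ i then Y else 0#) (allFin n))
          ≈⟨ +-cong (∑-indicator n p X) (∑-indicator n (suc r) Y) ⟩
        (if p <ᵇ n then X else 0#) + (if suc r <ᵇ n then Y else 0#)
          ≈⟨ +-congʳ (reflexive (if-cong (<ᵇ-true (ℕₚ.≤-<-trans p≤r r<n)))) ⟩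
        X + (if suc r <ᵇ n then Y else 0#) ∎
        where
        X Y : Carrier
        X = h (r ∸ p) * perFrom m (insert p used) (suc r)
        Y = c * perFrom m (insert (suc r) used) (suc r)

      perFrom-gapped : ∀ m {r p used} → p ≤ r → r ℕ.+ m ≡ n → used ≗ gapped r p →
                       perFrom m used r ≈ perShifted m (r ∸ p)
      perFrom-gapped zero          p≤r r+m≡n spec = ≈-refl
      perFrom-gapped (suc zero)    {r} {p} {used} p≤r r+1≡n spec = begin
        perFrom 1 used r                                      ≈⟨ row-expansion 0 p≤r (row<n r+1≡n) spec ⟩
        h (r ∸ p) * 1# + (if suc r <ᵇ n then c * 1# else 0#)  ≈⟨ +-congˡ (reflexive (if-cong last-row)) ⟩
        h (r ∸ p) * 1# + 0#                                   ≈⟨ +-identityʳ _ ⟩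
        h (r ∸ p) * 1#                                        ≈⟨ *-identityʳ _ ⟩
        h (r ∸ p)                                             ∎
        where
        last-row : (suc r <ᵇ n) ≡ false
        last-row = <ᵇ-false (ℕₚ.<-irrefl (≡.trans (ℕₚ.+-comm 1 r) r+1≡n))
      perFrom-gapped (suc (suc m)) {r} {p} {used} p≤r r+m≡n spec = begin
        perFrom (suc (suc m)) used r
          ≈⟨ row-expansion (suc m) p≤r (row<n r+m≡n) spec ⟩
        X + (if suc r <ᵇ n then Y else 0#)
          ≈⟨ +-congˡ (reflexive (if-cong (<ᵇ-true (row<n next-row)))) ⟩
        X + Y
          ≈⟨ +-cong (*-congˡ (perFrom-gapped (suc m) ℕₚ.≤-refl next-row (insert-at p≤r spec)))
                    (*-congˡ (perFrom-gapped (suc m) (ℕₚ.m≤n⇒m≤1+n p≤r) next-row (insert-next p≤r spec))) ⟩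
        h (r ∸ p) * perShifted (suc m) (r ∸ r) + c * perShifted (suc m) (suc r ∸ p)
          ≡⟨ cong₂ (λ d e → h (r ∸ p) * perShifted (suc m) d + c * perShifted (suc m) e)
                   (ℕₚ.n∸n≡0 r) (ℕₚ.+-∸-assoc 1 p≤r) ⟩
        perShifted (suc (suc m)) (r ∸ p) ∎
        where
        X Y : Carrier
        X = h (r ∸ p) * perFrom (suc m) (insert p used) (suc r)
        Y = c * perFrom (suc m) (insert (suc r) used) (suc r)
        next-row : suc r ℕ.+ suc m ≡ n
        next-row = ≡.trans (≡.sym (ℕₚ.+-suc r (suc m))) r+m≡n

      per-entry : per R n (λ r s → entry (toℕ r) (toℕ s)) ≈ perShifted n 0
      per-entry = ≈-trans per≈perFrom (perFrom-gapped n z≤n refl nothing-used)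
        where
        nothing-used : (λ _ → false) ≗ gapped 0 0
        nothing-used zero    = refl
        nothing-used (suc j) = refl

  module Fibonacci (k : ℕ) (t : ℕ → Carrier) where
    lookup-hist : ∀ q j → lookupOr0 R (hist R k t q) j ≡ F R k t (q ∸ j)
    lookup-hist zero          zero    = refl
    lookup-hist zero          (suc j) = refl
    lookup-hist (suc q)       zero    = refl
    lookup-hist (suc zero)    (suc j) = lookup-hist zero j
    lookup-hist (suc (suc q)) (suc j) = lookup-hist (suc q) j

    weight : ℕ → Carrier
    weight e = if e <ᵇ k then t (suc e) else 0#

    -- The terms j ≥ e of the sum Σ_{j<k} t_{j+1} F_{m+e+1−j} defining F_{m+e+2}, indexed by i = j − e.
    recurrenceTail : ℕ → ℕ → Carrier
    recurrenceTail m e = ∑ (map (λ i → t (suc (e ℕ.+ i)) * F R k t (suc m ∸ i)) (upTo (k ∸ e)))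

    F-recurrence : ∀ m → F R k t (suc (suc m)) ≡ recurrenceTail m 0
    F-recurrence m = cong ∑ (map-cong (λ j → cong (t (suc j) *_) (lookup-hist (suc m) j)) (upTo k))

    recurrenceTail-split : ∀ m e → recurrenceTail m e ≈ weight e * F R k t (suc m)
      + ∑ (map (λ i → t (suc (suc e ℕ.+ i)) * F R k t (m ∸ i)) (upTo (k ∸ suc e)))
    recurrenceTail-split m e with e <ᵇ k | <ᵇ-reflects-< e k
    ... | true  | ofʸ e<k rewrite ℕₚ.+-∸-assoc 1 e<k = +-cong
      (reflexive (cong (λ i → t (suc i) * F R k t (suc m)) (ℕₚ.+-identityʳ e)))
      (reflexive (cong ∑ (≡.trans (map-applyUpTo-suc (λ i → t (suc (e ℕ.+ i)) * F R k t (suc m ∸ i)) (k ∸ suc e))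
                                  (map-cong shift (upTo (k ∸ suc e))))))
      where
      shift : ∀ i → t (suc (e ℕ.+ suc i)) * F R k t (m ∸ i) ≡ t (suc (suc e ℕ.+ i)) * F R k t (m ∸ i)
      shift i = cong (λ j → t (suc j) * F R k t (m ∸ i)) (ℕₚ.+-suc e i)
    ... | false | ofⁿ e≮k
      rewrite ℕₚ.m≤n⇒m∸n≡0 (ℕₚ.≮⇒≥ e≮k) | ℕₚ.m≤n⇒m∸n≡0 (ℕₚ.m≤n⇒m≤1+n (ℕₚ.≮⇒≥ e≮k)) =
      ≈-sym (≈-trans (+-identityʳ _) (zeroˡ _))

    recurrenceTail-zero : ∀ e → recurrenceTail 0 e ≈ weight e
    recurrenceTail-zero e = begin
      recurrenceTail 0 e                               ≈⟨ recurrenceTail-split 0 e ⟩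
      weight e * 1# + ∑ (map term (upTo (k ∸ suc e)))  ≈⟨ +-cong (*-identityʳ _) (∑-zero term≈0 (upTo (k ∸ suc e))) ⟩
      weight e + 0#                                    ≈⟨ +-identityʳ _ ⟩
      weight e                                         ∎
      where
      term : ℕ → Carrier
      term i = t (suc (suc e ℕ.+ i)) * F R k t (0 ∸ i)
      term≈0 : ∀ i → term i ≈ 0#
      term≈0 i = ≈-trans (*-congˡ (reflexive (cong (F R k t) (ℕₚ.0∸n≡0 i)))) (zeroʳ _)

    module _ {c : Carrier} {h : ℕ → Carrier} (weighted : ∀ e → c ^ e * h e ≈ weight e) where
      open ToeplitzHessenberg c h using (perShifted)

      perShifted≈recurrenceTail : ∀ m e → c ^ e * perShifted (suc m) e ≈ recurrenceTail m e
      perShifted≈recurrenceTail zero    e = ≈-trans (weighted e) (≈-sym (recurrenceTail-zero e))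
      perShifted≈recurrenceTail (suc m) e = begin
        c ^ e * (h e * perShifted (suc m) 0 + c * perShifted (suc m) (suc e))
          ≈⟨ distribˡ _ _ _ ⟩
        c ^ e * (h e * perShifted (suc m) 0) + c ^ e * (c * perShifted (suc m) (suc e))
          ≈⟨ +-cong (≈-sym (*-assoc _ _ _)) (≈-trans (≈-sym (*-assoc _ _ _)) (*-congʳ (*-comm _ _))) ⟩
        (c ^ e * h e) * perShifted (suc m) 0 + c ^ suc e * perShifted (suc m) (suc e)
          ≈⟨ +-cong (*-cong (weighted e) (≈-trans (≈-sym (*-identityˡ _)) (perShifted≈recurrenceTail m 0)))
                    (perShifted≈recurrenceTail m (suc e)) ⟩
        weight e * recurrenceTail m 0 + recurrenceTail m (suc e)
          ≡⟨ cong (λ x → weight e * x + recurrenceTail m (suc e)) (≡.sym (F-recurrence m)) ⟩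
        weight e * F R k t (suc (suc m)) + recurrenceTail m (suc e)
          ≈⟨ recurrenceTail-split (suc m) e ⟨
        recurrenceTail (suc m) e ∎

      perShifted≈F : ∀ m → perShifted m 0 ≈ F R k t (suc m)
      perShifted≈F zero    = ≈-refl
      perShifted≈F (suc m) = begin
        perShifted (suc m) 0       ≈⟨ *-identityˡ _ ⟨
        1# * perShifted (suc m) 0  ≈⟨ perShifted≈recurrenceTail m 0 ⟩
        recurrenceTail m 0         ≡⟨ F-recurrence m ⟨
        F R k t (suc (suc m))      ∎

theorem3p5 : ∀ {c ℓ} (R : CommutativeRing c ℓ) (k : ℕ) → 2 ≤ k → (n : ℕ) → 1 ≤ n →
    (t : ℕ → CommutativeRing.Carrier R) (u : CommutativeRing.Carrier R) →
    CommutativeRing._≈_ R (CommutativeRing._*_ R u (t 2)) (CommutativeRing.1# R) →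
    CommutativeRing._≈_ R (per R n (Lmat R k t u n)) (F R k t (suc n))
-- Lmat R k t u n is definitionally the matrix entry for c = t 2 and the h below.
theorem3p5 R k _ n _ t u u*t₂≈1 = trans (per-entry {n = n}) (perShifted≈F weighted n)
  where
  open CommutativeRing R using (_≈_; _*_; 0#; trans; zeroʳ)
  open Fibonacci R k t
  h : ℕ → CommutativeRing.Carrier R
  h d = if d <ᵇ k then t (suc d) * _^_ R u d else 0#
  open ToeplitzHessenberg R (t 2) h
  weighted : ∀ e → _^_ R (t 2) e * h e ≈ weight e
  weighted e with e <ᵇ k
  ... | true  = ^-cancel R u*t₂≈1 e (t (suc e))
  ... | false = zeroʳ _
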